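{- Let $\tau$ be a skew shape. For each $(u,v)\in\mathrm{Rem}_\tau$, the set $\xi^\tau_{u,v}$ is an ${\sf SE}$-removable ribbon in $\tau$; and every ${\sf SE}$-removable ribbon in $\tau$ equals $\xi^\tau_{u,v}$ for some $(u,v)\in\mathrm{Rem}_\tau$.
   Context: Nodes are elements of $\mathbb{Z}\times\mathbb{Z}$; $u=(u_1,u_2)$ lies in row $u_1$ (increasing southward), column $u_2$ (increasing eastward). ${\sf N}(i,j)=(i-1,j)$, ${\sf E}(i,j)=(i,j+1)$, ${\sf S}(i,j)=(i+1,j)$, ${\sf W}(i,j)=(i,j-1)$, ${\sf SE}(i,j)=(i+1,j+1)$. $u\searrow v$ means $v=u+(k,\ell)$, $k,\ell\ge0$; $u\nearrow v$ means $v=u+(-k,\ell)$, $k,\ell\ge0$. A finite set $\tau$ of nodes is a skew shape if $u,w\in\tau$, $u\searrow v\searrow w$ imply $v\in\tau$; connected if any two nodes are joined by a path of ${\sf N},{\sf E},{\sf S},{\sf W}$ steps inside $\tau$; connected components are maximal connected subsets; thin if it meets each diagonal $\{u:u_2-u_1=n\}$ in at most one node. A ribbon is a nonempty thin connected skew shape. A tableau $(\lambda_1,\lambda_2)$ for $\tau$ is a pair of disjoint nonempty skew shapes with union $\tau$ such that no $u\in\lambda_2$, $v\in\lambda_1$ satisfy $u\searrow v$. A skew shape $\mu\subseteq\tau$ is ${\sf SE}$-removable in $\tau$ if $\mu=\tau$ or $(\tau\setminus\mu,\mu)$ is a tableau for $\tau$. $\mathrm{Rem}_\tau$ is the set of pairs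 $(u,v)$ of nodes of $\tau$ lying in the same connected component of $\tau$ with $u\nearrow v$ and ${\sf S}u\notin\tau$, ${\sf E}v\notin\tau$. For $(u,v)\in\mathrm{Rem}_\tau$, $\xi^\tau_{u,v}=\{w\in\tau\mid u\nearrow w\nearrow v,\ {\sf SE}w\notin\tau\}$. -}

module Defs where

open import Data.Integer using (ℤ; _+_; _-_; +_)
open import Data.Nat using (ℕ)
open import Data.Product using (_×_; _,_; Σ; ∃; proj₁; proj₂)
open import Data.Sum using (_⊎_)
open import Data.Empty using (⊥)
open import Data.List using (List)
open import Data.List.Membership.Propositional using (_∈_)
open import Relation.Binary.PropositionalEquality using (_≡_)
open import Relation.Nullary using (¬_)

-- Nodes: (row, column); rows increase southward, columns eastward.
Node : Set
Node = ℤ × ℤ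

N E S W SE : Node → Node
N (i , j) = (i - + 1 , j)
E (i , j) = (i , j + + 1)
S (i , j) = (i + + 1 , j)
W (i , j) = (i , j - + 1)
SE (i , j) = (i + + 1 , j + + 1)

_↘_ : Node → Node → Set
u ↘ v = Σ ℕ λ k → Σ ℕ λ l → v ≡ (proj₁ u + + k , proj₂ u + + l)

_↗_ : Node → Node → Set
u ↗ v = Σ ℕ λ k → Σ ℕ λ l → v ≡ (proj₁ u - + k , proj₂ u + + l)

NodeSet : Set₁
NodeSet = Node → Set

⟦_⟧ : List Node → NodeSet
⟦ xs ⟧ u = u ∈ xs

_⊆_ : NodeSet → NodeSet → Set
A ⊆ B = ∀ u → A u → B u

_≐_ : NodeSet → NodeSet → Set
A ≐ B = (A ⊆ B) × (B ⊆ A)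

_∖_ : NodeSet → NodeSet → NodeSet
(A ∖ B) u = A u × ¬ B u

Finite : NodeSet → Set
Finite A = ∃ λ (xs : List Node) → A ⊆ ⟦ xs ⟧

Nonempty : NodeSet → Set
Nonempty A = ∃ λ u → A u

SkewShape : NodeSet → Set
SkewShape τ = Finite τ ×
  (∀ u v w → τ u → τ w → u ↘ v → v ↘ w → τ v)

Step : Node → Node → Set
Step u v = (v ≡ N u) ⊎ (v ≡ E u) ⊎ (v ≡ S u) ⊎ (v ≡ W u)

data Path (τ : NodeSet) : Node → Node → Set where
  here : ∀ {u} → τ u → Path τ u u
  step : ∀ {u v w} → τ u → Step u v → Path τ v w → Path τ u w

SameComponent : NodeSet → Node → Node → Set
SameComponent τ u v = τ u × τ v × Path τ u v

Connected : NodeSet → Set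
Connected τ = ∀ u v → τ u → τ v → Path τ u v

diag : Node → ℤ
diag (i , j) = j - i

Thin : NodeSet → Set
Thin τ = ∀ u v → τ u → τ v → diag u ≡ diag v → u ≡ v

Ribbon : NodeSet → Set
Ribbon ρ = Nonempty ρ × Thin ρ × Connected ρ × SkewShape ρ

Tableau : NodeSet → NodeSet → NodeSet → Set
Tableau τ λ₁ λ₂ =
  SkewShape λ₁ × SkewShape λ₂ × Nonempty λ₁ × Nonempty λ₂ ×
  (∀ u → λ₁ u → λ₂ u → ⊥) ×
  (∀ u → τ u → λ₁ u ⊎ λ₂ u) × (λ₁ ⊆ τ) × (λ₂ ⊆ τ) ×
  (∀ u v → λ₂ u → λ₁ v → ¬ (u ↘ v))

SERemovable : NodeSet → NodeSet → Set
SERemovable τ μ = SkewShape μ × (μ ⊆ τ) × ((μ ≐ τ) ⊎ Tableau τ (τ ∖ μ) μ)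

Rem : NodeSet → Node → Node → Set
Rem τ u v = SameComponent τ u v × u ↗ v × ¬ τ (S u) × ¬ τ (E v)

ξ : NodeSet → Node → Node → NodeSet
ξ τ u v w = τ w × u ↗ w × w ↗ v × ¬ τ (SE w)

{-# OPTIONS --safe #-}
-- A nonempty subset of a skew shape τ is SE-removable exactly when it is closed upwards
-- under ↘ within τ. For (u, v) ∈ Rem τ, the set ξ is such an up-set (S u, E v ∉ τ keep it
-- between u and v); it is thin because none of its nodes has its SE neighbour in τ; and it is
-- connected because from each of its nodes other than v one can step N or E inside it, the
-- N step being supplied by the place where the path from u to v climbs above the current row.
-- Conversely a removable ribbon ρ is an up-set; its nodes u, v of least and greatest diagonal
-- form a pair in Rem τ, thinness of ρ puts ρ inside ξ, and since ρ meets every diagonal between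
-- u and v, up-closedness puts ξ inside ρ.
module Submission where

open import Defs
open import Data.Empty using (⊥-elim)
open import Data.Integer using (ℤ; +_; _+_; _-_; -1ℤ; _≤_; _<_; _≤?_; _<?_; ∣_∣)
import Data.Integer.Properties as ℤ
open import Data.Integer.Tactic.RingSolver using (solve-∀)
open import Data.List using (List)
open import Data.List.Extrema ℤ.≤-totalOrder
  using (argmin; argmax; argmin-all; argmax-all; f[argmin]≤f[xs]; f[xs]≤f[argmax])
open import Data.List.Membership.Propositional using (_∈_; find)
open import Data.List.Relation.Unary.All using (all?; lookup; tabulate)
open import Data.List.Relation.Unary.All.Properties using (¬All⇒Any¬)
open import Data.Nat using (zero; suc)
open import Data.Product using (_×_; _,_; proj₁; proj₂; ∃; ∃₂)
open import Data.Product.Properties using (≡-dec)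
open import Data.Sum using (_⊎_; inj₁; inj₂)
open import Relation.Binary.PropositionalEquality
open import Relation.Binary.Definitions using (tri<; tri≈; tri>)
open import Relation.Nullary using (¬_; Dec; yes; no)
open import Relation.Nullary.Decidable using (_×-dec_; ¬?; map′)
open import Relation.Unary using (Decidable)

row col : Node → ℤ
row = proj₁
col = proj₂

_≟ₙ_ : (u v : Node) → Dec (u ≡ v)
_≟ₙ_ = ≡-dec ℤ._≟_ ℤ._≟_

open import Data.List.Membership.DecPropositional _≟ₙ_ using (_∈?_)

private
  variable
    i j : ℤ
    a b u v w x y : Node
    A B τ μ : NodeSet

i≤i+1 : ∀ i → i ≤ i + + 1
i≤i+1 i = ℤ.i≤i+j i (+ 1)

i-1≤i : ∀ i → i - + 1 ≤ i
i-1≤i i = ℤ.i-j≤i i (+ 1)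

i<i+1 : ∀ i → i < i + + 1
i<i+1 i = ℤ.suc[i]≤j⇒i<j (ℤ.≤-reflexive (ℤ.+-comm (+ 1) i))

i-1<i : ∀ i → i - + 1 < i
i-1<i i = ℤ.i≤pred[j]⇒i<j (ℤ.≤-reflexive (ℤ.+-comm i -1ℤ))

<⇒+1≤ : i < j → i + + 1 ≤ j
<⇒+1≤ {i} i<j = subst (_≤ _) (ℤ.+-comm (+ 1) i) (ℤ.i<j⇒suc[i]≤j i<j)

<⇒≤-1 : i < j → i ≤ j - + 1
<⇒≤-1 {j = j} i<j = subst (_ ≤_) (ℤ.+-comm -1ℤ j) (ℤ.i<j⇒i≤pred[j] i<j)

j≡i+[j-i] : ∀ i j → j ≡ i + (j - i)
j≡i+[j-i] = solve-∀

j≡i-[i-j] : ∀ i j → j ≡ i - (i - j)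
j≡i-[i-j] = solve-∀

i-1+1≡i : ∀ i → i - + 1 + + 1 ≡ i
i-1+1≡i = solve-∀

i+1-1≡i : ∀ i → i + + 1 - + 1 ≡ i
i+1-1≡i = solve-∀

≤⇒+-offset : i ≤ j → ∃ λ n → j ≡ i + + n
≤⇒+-offset {i} {j} i≤j = ∣ j - i ∣ , (begin
  j               ≡⟨ j≡i+[j-i] i j ⟩
  i + (j - i)     ≡⟨ cong (λ k → i + k) (ℤ.0≤i⇒+∣i∣≡i (ℤ.i≤j⇒0≤j-i i≤j)) ⟨
  i + + ∣ j - i ∣ ∎)
  where open ≡-Reasoning

≤⇒--offset : j ≤ i → ∃ λ n → j ≡ i - + n
≤⇒--offset {j} {i} j≤i = ∣ i - j ∣ , (begin
  j               ≡⟨ j≡i-[i-j] i j ⟩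
  i - (i - j)     ≡⟨ cong (λ k → i - k) (ℤ.0≤i⇒+∣i∣≡i (ℤ.i≤j⇒0≤j-i j≤i)) ⟨
  i - + ∣ i - j ∣ ∎)
  where open ≡-Reasoning

↘-intro : row u ≤ row v → col u ≤ col v → u ↘ v
↘-intro r≤ c≤ with ≤⇒+-offset r≤ | ≤⇒+-offset c≤
... | k , r≡ | l , c≡ = k , l , cong₂ _,_ r≡ c≡

↘-row : u ↘ v → row u ≤ row v
↘-row {u} (k , _ , refl) = ℤ.i≤i+j (row u) (+ k)

↘-col : u ↘ v → col u ≤ col v
↘-col {u} (_ , l , refl) = ℤ.i≤i+j (col u) (+ l)

↗-intro : row v ≤ row u → col u ≤ col v → u ↗ v
↗-intro r≤ c≤ with ≤⇒--offset r≤ | ≤⇒+-offset c≤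
... | k , r≡ | l , c≡ = k , l , cong₂ _,_ r≡ c≡

↗-row : u ↗ v → row v ≤ row u
↗-row {u} (k , _ , refl) = ℤ.i-j≤i (row u) (+ k)

↗-col : u ↗ v → col u ≤ col v
↗-col {u} (_ , l , refl) = ℤ.i≤i+j (col u) (+ l)

↗-refl : u ↗ u
↗-refl = ↗-intro ℤ.≤-refl ℤ.≤-refl

↘S : ∀ u → u ↘ S u
↘S u = ↘-intro (i≤i+1 (row u)) ℤ.≤-refl

↘E : ∀ u → u ↘ E u
↘E u = ↘-intro ℤ.≤-refl (i≤i+1 (col u))

↘SE : ∀ u → u ↘ SE u
↘SE u = ↘-intro (i≤i+1 (row u)) (i≤i+1 (col u))

N↘ : ∀ u → N u ↘ u
N↘ u = ↘-intro (i-1≤i (row u)) ℤ.≤-refl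

W↘ : ∀ u → W u ↘ u
W↘ u = ↘-intro ℤ.≤-refl (i-1≤i (col u))

↘-S : u ↘ w → row u < row w → S u ↘ w
↘-S {u} u↘w r< = ↘-intro (<⇒+1≤ r<) (↘-col {u} u↘w)

↘-E : u ↘ w → col u < col w → E u ↘ w
↘-E {u} u↘w c< = ↘-intro (↘-row {u} u↘w) (<⇒+1≤ c<)

↘-N : w ↘ u → row w < row u → w ↘ N u
↘-N {w} w↘u r< = ↘-intro (<⇒≤-1 r<) (↘-col {w} w↘u)

↘-W : w ↘ u → col w < col u → w ↘ W u
↘-W {w} w↘u c< = ↘-intro (↘-row {w} w↘u) (<⇒≤-1 c<)

↘-SE : u ↘ w → SE u ↘ SE w
↘-SE {u} u↘w = ↘-intro (ℤ.+-monoˡ-≤ (+ 1) (↘-row {u} u↘w)) (ℤ.+-monoˡ-≤ (+ 1) (↘-col {u} u↘w))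

↗? : ∀ u v → Dec (u ↗ v)
↗? u v = map′ (λ (r≤ , c≤) → ↗-intro r≤ c≤) (λ u↗v → ↗-row {u} u↗v , ↗-col {u} u↗v)
              ((row v ≤? row u) ×-dec (col u ≤? col v))

diag-N : ∀ u → diag (N u) ≡ diag u + + 1
diag-N (i , j) = lemma i j
  where lemma : ∀ i j → j - (i - + 1) ≡ (j - i) + + 1
        lemma = solve-∀

diag-E : ∀ u → diag (E u) ≡ diag u + + 1
diag-E (i , j) = lemma i j
  where lemma : ∀ i j → (j + + 1) - i ≡ (j - i) + + 1
        lemma = solve-∀

diag-S : ∀ u → diag (S u) ≡ diag u - + 1
diag-S (i , j) = lemma i j
  where lemma : ∀ i j → j - (i + + 1) ≡ (j - i) - + 1
        lemma = solve-∀

diag-W : ∀ u → diag (W u) ≡ diag u - + 1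
diag-W (i , j) = lemma i j
  where lemma : ∀ i j → (j - + 1) - i ≡ (j - i) - + 1
        lemma = solve-∀

diag-SE : ∀ u → diag (SE u) ≡ diag u
diag-SE (i , j) = lemma i j
  where lemma : ∀ i j → (j + + 1) - (i + + 1) ≡ j - i
        lemma = solve-∀

col≡diag+row : ∀ u → col u ≡ diag u + row u
col≡diag+row (i , j) = lemma i j
  where lemma : ∀ i j → j ≡ (j - i) + i
        lemma = solve-∀

diag-step : Step x y → diag y ≤ diag x + + 1
diag-step {x} (inj₁ refl)               = ℤ.≤-reflexive (diag-N x)
diag-step {x} (inj₂ (inj₁ refl))        = ℤ.≤-reflexive (diag-E x)
diag-step {x} (inj₂ (inj₂ (inj₁ refl))) =
  ℤ.≤-trans (ℤ.≤-reflexive (diag-S x)) (ℤ.≤-trans (i-1≤i (diag x)) (i≤i+1 (diag x)))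
diag-step {x} (inj₂ (inj₂ (inj₂ refl))) =
  ℤ.≤-trans (ℤ.≤-reflexive (diag-W x)) (ℤ.≤-trans (i-1≤i (diag x)) (i≤i+1 (diag x)))

↗⇒diag≤ : u ↗ v → diag u ≤ diag v
↗⇒diag≤ {u} u↗v = ℤ.+-mono-≤ (↗-col {u} u↗v) (ℤ.neg-mono-≤ (↗-row {u} u↗v))

diag≤∧row≤⇒col≤ : diag x ≤ diag y → row x ≤ row y → col x ≤ col y
diag≤∧row≤⇒col≤ {x} {y} d≤ r≤ =
  subst₂ _≤_ (sym (col≡diag+row x)) (sym (col≡diag+row y)) (ℤ.+-mono-≤ d≤ r≤)

diag≤∧col<⇒row< : diag x ≤ diag y → col y < col x → row y < row x
diag≤∧col<⇒row< {x} {y} d≤ c< with row x ≤? row y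
... | yes r≤ = ⊥-elim (ℤ.<⇒≱ c< (diag≤∧row≤⇒col≤ {x} {y} d≤ r≤))
... | no  r≰ = ℤ.≰⇒> r≰

sameDiag⇒↘ : diag x ≡ diag y → row x ≤ row y → x ↘ y
sameDiag⇒↘ {x} {y} d≡ r≤ = ↘-intro r≤ (diag≤∧row≤⇒col≤ {x} {y} (ℤ.≤-reflexive d≡) r≤)

sameDiag⇒SE↘ : diag x ≡ diag y → row x < row y → SE x ↘ y
sameDiag⇒SE↘ {x} {y} d≡ r< =
  sameDiag⇒↘ {SE x} {y} (trans (diag-SE x) d≡) (<⇒+1≤ r<)

sameDiag∧sameRow⇒≡ : diag x ≡ diag y → row x ≡ row y → x ≡ y
sameDiag∧sameRow⇒≡ {x} {y} d≡ r≡ = cong₂ _,_ r≡ (begin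
  col x           ≡⟨ col≡diag+row x ⟩
  diag x + row x  ≡⟨ cong₂ _+_ d≡ r≡ ⟩
  diag y + row y  ≡⟨ col≡diag+row y ⟨
  col y           ∎)
  where open ≡-Reasoning

diag-S< : ∀ u → diag (S u) < diag u
diag-S< u = subst (_< diag u) (sym (diag-S u)) (i-1<i (diag u))

diag-W< : ∀ u → diag (W u) < diag u
diag-W< u = subst (_< diag u) (sym (diag-W u)) (i-1<i (diag u))

diag<diag-N : ∀ u → diag u < diag (N u)
diag<diag-N u = subst (diag u <_) (sym (diag-N u)) (i<i+1 (diag u))

diag<diag-E : ∀ u → diag u < diag (E u)
diag<diag-E u = subst (diag u <_) (sym (diag-E u)) (i<i+1 (diag u))

SE≢ : ∀ u → SE u ≢ u
SE≢ u SEu≡u = ℤ.<-irrefl (sym (cong row SEu≡u)) (i<i+1 (row u))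

↗∧sameDiag⇒≡ : u ↗ v → diag u ≡ diag v → u ≡ v
↗∧sameDiag⇒≡ {u} {v} u↗v d≡ with row v <? row u
... | yes v<u = ⊥-elim (ℤ.<-irrefl refl (ℤ.<-≤-trans (i<i+1 (col v))
                  (ℤ.≤-trans (↘-col {SE v} (sameDiag⇒SE↘ {v} {u} (sym d≡) v<u)) (↗-col {u} u↗v))))
... | no  v≮u = sameDiag∧sameRow⇒≡ d≡ (ℤ.≤-antisym (ℤ.≮⇒≥ v≮u) (↗-row {u} u↗v))

between : SkewShape τ → τ a → τ b → a ↘ x → x ↘ b → τ x
between sk τa τb a↘x x↘b = proj₂ sk _ _ _ τa τb a↘x x↘b

SE-between : SkewShape τ → τ x → τ y → diag x ≡ diag y → row x < row y → τ (SE x)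
SE-between {x = x} {y} sk τx τy d≡ r< = between sk τx τy (↘SE x) (sameDiag⇒SE↘ {x} {y} d≡ r<)

SE-free⇒thin : SkewShape τ → (∀ {w} → A w → τ w × ¬ τ (SE w)) → Thin A
SE-free⇒thin sk A⇒ w w′ Aw Aw′ d≡ with A⇒ Aw | A⇒ Aw′ | ℤ.<-cmp (row w) (row w′)
... | τw , SEw∉τ | τw′ , _     | tri< w<w′ _ _ = ⊥-elim (SEw∉τ (SE-between sk τw τw′ d≡ w<w′))
... | _          | _           | tri≈ _ w≡w′ _ = sameDiag∧sameRow⇒≡ d≡ w≡w′
... | τw , _     | τw′ , SEw′∉τ | tri> _ _ w′<w = ⊥-elim (SEw′∉τ (SE-between sk τw′ τw (sym d≡) w′<w))

diag-minimum⇒↗ : SkewShape A → A u → (∀ {w} → A w → diag u ≤ diag w) → A w → u ↗ w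
diag-minimum⇒↗ {u = u} {w = w} sk Au minimum Aw = ↗-intro w≤u u≤w
  where
  w≤u : row w ≤ row u
  w≤u with row w ≤? row u
  ... | yes w≤u = w≤u
  ... | no  w≰u = ⊥-elim (ℤ.<⇒≱ (diag-S< u) (minimum (between sk Au Aw (↘S u) (↘-S {u} u↘w u<w))))
    where
    u<w : row u < row w
    u<w = ℤ.≰⇒> w≰u
    u↘w : u ↘ w
    u↘w = ↘-intro (ℤ.<⇒≤ u<w) (diag≤∧row≤⇒col≤ {u} {w} (minimum Aw) (ℤ.<⇒≤ u<w))
  u≤w : col u ≤ col w
  u≤w with col u ≤? col w
  ... | yes u≤w = u≤w
  ... | no  u≰w = ⊥-elim (ℤ.<⇒≱ (diag-W< u) (minimum (between sk Aw Au (↘-W {w} w↘u w<u) (W↘ u))))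
    where
    w<u : col w < col u
    w<u = ℤ.≰⇒> u≰w
    w↘u : w ↘ u
    w↘u = ↘-intro (ℤ.<⇒≤ (diag≤∧col<⇒row< {u} {w} (minimum Aw) w<u)) (ℤ.<⇒≤ w<u)

diag-maximum⇒↗ : SkewShape A → A v → (∀ {w} → A w → diag w ≤ diag v) → A w → w ↗ v
diag-maximum⇒↗ {v = v} {w = w} sk Av maximum Aw = ↗-intro v≤w w≤v
  where
  v≤w : row v ≤ row w
  v≤w with row v ≤? row w
  ... | yes v≤w = v≤w
  ... | no  v≰w = ⊥-elim (ℤ.<⇒≱ (diag<diag-N v) (maximum (between sk Aw Av (↘-N {w} w↘v w<v) (N↘ v))))
    where
    w<v : row w < row v
    w<v = ℤ.≰⇒> v≰w
    w↘v : w ↘ v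
    w↘v = ↘-intro (ℤ.<⇒≤ w<v) (diag≤∧row≤⇒col≤ {w} {v} (maximum Aw) (ℤ.<⇒≤ w<v))
  w≤v : col w ≤ col v
  w≤v with col w ≤? col v
  ... | yes w≤v = w≤v
  ... | no  w≰v = ⊥-elim (ℤ.<⇒≱ (diag<diag-E v) (maximum (between sk Av Aw (↘E v) (↘-E {v} v↘w v<w))))
    where
    v<w : col v < col w
    v<w = ℤ.≰⇒> w≰v
    v↘w : v ↘ w
    v↘w = ↘-intro (ℤ.<⇒≤ (diag≤∧col<⇒row< {w} {v} (maximum Aw) v<w)) (ℤ.<⇒≤ v<w)

⊆-finite : A ⊆ B → Finite B → Finite A
⊆-finite A⊆B (xs , B⊆xs) = xs , λ w Aw → B⊆xs w (A⊆B w Aw)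

UpClosed : NodeSet → NodeSet → Set
UpClosed τ μ = ∀ {a b} → μ a → τ b → a ↘ b → μ b

upClosed⇒skewShape : SkewShape τ → μ ⊆ τ → UpClosed τ μ → SkewShape μ
upClosed⇒skewShape sk μ⊆τ up =
  ⊆-finite μ⊆τ (proj₁ sk) ,
  λ a x b μa μb a↘x x↘b → up μa (between sk (μ⊆τ a μa) (μ⊆τ b μb) a↘x x↘b) a↘x

upClosed⇒∖-skewShape : SkewShape τ → UpClosed τ μ → SkewShape (τ ∖ μ)
upClosed⇒∖-skewShape sk up =
  ⊆-finite (λ _ → proj₁) (proj₁ sk) ,
  λ a x b (τa , _) (τb , μb̸) a↘x x↘b →
    let τx = between sk τa τb a↘x x↘b in τx , λ μx → μb̸ (up μx τb x↘b)

removable⇒upClosed : SERemovable τ μ → UpClosed τ μ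
removable⇒upClosed (_ , _ , inj₁ (_ , τ⊆μ)) _ τb _ = τ⊆μ _ τb
removable⇒upClosed (_ , _ , inj₂ (_ , _ , _ , _ , _ , cover , _ , _ , no↘)) {a} {b} μa τb a↘b
  with cover b τb
... | inj₁ (_ , μb̸) = ⊥-elim (no↘ a b μa (τb , μb̸) a↘b)
... | inj₂ μb       = μb

upClosed⇒removable : (τ : List Node) → SkewShape ⟦ τ ⟧ → Decidable μ → Nonempty μ →
                     μ ⊆ ⟦ τ ⟧ → UpClosed ⟦ τ ⟧ μ → SERemovable ⟦ τ ⟧ μ
upClosed⇒removable {μ} τ sk μ? μ≠∅ μ⊆τ up = skew-μ , μ⊆τ , whole-or-tableau
  where
  skew-μ : SkewShape μ
  skew-μ = upClosed⇒skewShape sk μ⊆τ up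

  cover : ∀ w → ⟦ τ ⟧ w → (⟦ τ ⟧ ∖ μ) w ⊎ μ w
  cover w w∈τ with μ? w
  ... | yes μw = inj₂ μw
  ... | no  μw̸ = inj₁ (w∈τ , μw̸)

  whole-or-tableau : (μ ≐ ⟦ τ ⟧) ⊎ Tableau ⟦ τ ⟧ (⟦ τ ⟧ ∖ μ) μ
  whole-or-tableau with all? μ? τ
  ... | yes τ⊆μ = inj₁ (μ⊆τ , λ _ → lookup τ⊆μ)
  ... | no  τ⊈μ with find (¬All⇒Any¬ μ? τ τ⊈μ)
  ...   | w , w∈τ , μw̸ = inj₂
    ( upClosed⇒∖-skewShape sk up , skew-μ , (w , w∈τ , μw̸) , μ≠∅
    , (λ _ (_ , μw̸) μw → μw̸ μw) , cover , (λ _ → proj₁) , μ⊆τ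
    , λ a b μa (τb , μb̸) a↘b → μb̸ (up μa τb a↘b) )

Step-sym : Step x y → Step y x
Step-sym {x} (inj₁ refl)               = inj₂ (inj₂ (inj₁ (cong (_, col x) (sym (i-1+1≡i (row x))))))
Step-sym {x} (inj₂ (inj₁ refl))        = inj₂ (inj₂ (inj₂ (cong (row x ,_) (sym (i+1-1≡i (col x))))))
Step-sym {x} (inj₂ (inj₂ (inj₁ refl))) = inj₁ (cong (_, col x) (sym (i+1-1≡i (row x))))
Step-sym {x} (inj₂ (inj₂ (inj₂ refl))) = inj₂ (inj₁ (cong (row x ,_) (sym (i-1+1≡i (col x)))))

Path-head : Path A a b → A a
Path-head (here Aa)     = Aa
Path-head (step Aa _ _) = Aa

Path-map : A ⊆ B → Path A a b → Path B a b
Path-map A⊆B (here Aa)       = here (A⊆B _ Aa)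
Path-map A⊆B (step Aa s p)   = step (A⊆B _ Aa) s (Path-map A⊆B p)

Path-++ : Path A a b → Path A b x → Path A a x
Path-++ (here _)      q = q
Path-++ (step Aa s p) q = step Aa s (Path-++ p q)

Path-reverse : Path A a b → Path A b a
Path-reverse (here Aa)     = here Aa
Path-reverse (step Aa s p) = Path-++ (Path-reverse p) (step (Path-head p) (Step-sym s) (here Aa))

Path-diag-ivt : ∀ d → Path A a b → diag a ≤ d → d ≤ diag b → ∃ λ x → A x × diag x ≡ d
Path-diag-ivt d (here Aa) a≤d d≤b = _ , Aa , ℤ.≤-antisym a≤d d≤b
Path-diag-ivt {a = a} d (step Aa s p) a≤d d≤b with diag a ℤ.≟ d
... | yes a≡d = a , Aa , a≡d
... | no  a≢d = Path-diag-ivt d p (ℤ.≤-trans (diag-step s) (<⇒+1≤ (ℤ.≤∧≢⇒< a≤d a≢d))) d≤b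

-- A path climbing from the row of w to above it does so by an N step a → N a; according as
-- col a ≤ col w or col w < col a, the node N w or E w is squeezed between w and that step.
north-or-east : SkewShape τ → τ w → Path τ a b → row w ≤ row a → row b < row w →
                τ (N w) ⊎ τ (E w)
north-or-east sk τw (here _) w≤a b<w = ⊥-elim (ℤ.<-irrefl refl (ℤ.≤-<-trans w≤a b<w))
north-or-east {w = w} sk τw (step {u = a} τa (inj₁ refl) p) w≤a b<w with row w ≤? row (N a)
... | yes w≤Na = north-or-east sk τw p w≤Na b<w
... | no  w≰Na with col a ≤? col w
...   | yes a≤w = inj₁ (between sk (Path-head p) τw (↘-intro (<⇒≤-1 (ℤ.≰⇒> w≰Na)) a≤w) (N↘ w))
...   | no  a≰w = inj₂ (between sk τw τa (↘E w) (↘-intro w≤a (<⇒+1≤ (ℤ.≰⇒> a≰w))))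
north-or-east sk τw (step τa (inj₂ (inj₁ refl)) p) w≤a b<w = north-or-east sk τw p w≤a b<w
north-or-east sk τw (step {u = a} τa (inj₂ (inj₂ (inj₁ refl))) p) w≤a b<w =
  north-or-east sk τw p (ℤ.≤-trans w≤a (i≤i+1 (row a))) b<w
north-or-east sk τw (step τa (inj₂ (inj₂ (inj₂ refl))) p) w≤a b<w = north-or-east sk τw p w≤a b<w

connected-by-N/E-steps : (∀ {w} → A w → w ↗ v) → (∀ {w} → A w → w ≢ v → A (N w) ⊎ A (E w)) →
                         Connected A
connected-by-N/E-steps {A} {v} A⇒↗v advance a b Aa Ab =
  Path-++ (path-to-v Aa) (Path-reverse (path-to-v Ab))
  where
  shift : ∀ {i j} n → j ≡ i + + 1 → j + + n ≡ i + + suc n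
  shift {i} n refl = ℤ.+-assoc i (+ 1) (+ n)

  path-to : ∀ n {w} → A w → diag w + + n ≡ diag v → Path A w v
  path-to zero {w} Aw d≡ =
    subst (Path A w) (↗∧sameDiag⇒≡ (A⇒↗v Aw) (trans (sym (ℤ.+-identityʳ (diag w))) d≡)) (here Aw)
  path-to (suc n) {w} Aw d≡ with w ≟ₙ v
  ... | yes refl = here Aw
  ... | no  w≢v with advance Aw w≢v
  ...   | inj₁ A-Nw = step Aw (inj₁ refl) (path-to n A-Nw (trans (shift {diag w} n (diag-N w)) d≡))
  ...   | inj₂ A-Ew = step Aw (inj₂ (inj₁ refl)) (path-to n A-Ew (trans (shift {diag w} n (diag-E w)) d≡))

  path-to-v : ∀ {w} → A w → Path A w v
  path-to-v {w} Aw with ≤⇒+-offset (↗⇒diag≤ {w} (A⇒↗v Aw))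
  ... | n , d≡ = path-to n Aw (sym d≡)

module _ {τ : List Node} (sk : SkewShape ⟦ τ ⟧) {u v : Node} (rem : Rem ⟦ τ ⟧ u v) where

  private
    τu : ⟦ τ ⟧ u
    τu = proj₁ (proj₁ rem)

    τv : ⟦ τ ⟧ v
    τv = proj₁ (proj₂ (proj₁ rem))

    path-u-v : Path ⟦ τ ⟧ u v
    path-u-v = proj₂ (proj₂ (proj₁ rem))

    u↗v : u ↗ v
    u↗v = proj₁ (proj₂ rem)

    Su∉τ : ¬ ⟦ τ ⟧ (S u)
    Su∉τ = proj₁ (proj₂ (proj₂ rem))

    Ev∉τ : ¬ ⟦ τ ⟧ (E v)
    Ev∉τ = proj₂ (proj₂ (proj₂ rem))

  ξ-upClosed : UpClosed ⟦ τ ⟧ (ξ ⟦ τ ⟧ u v)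
  ξ-upClosed {a} {b} (τa , u↗a , a↗v , SEa∉τ) τb a↘b = τb , u↗b , b↗v , SEb∉τ
    where
    u≤b : col u ≤ col b
    u≤b = ℤ.≤-trans (↗-col {u} u↗a) (↘-col {a} a↘b)

    b≤u : row b ≤ row u
    b≤u with row b ≤? row u
    ... | yes b≤u = b≤u
    ... | no  b≰u = ⊥-elim (Su∉τ (between sk τu τb (↘S u) (↘-S {u} (↘-intro (ℤ.<⇒≤ u<b) u≤b) u<b)))
      where u<b : row u < row b
            u<b = ℤ.≰⇒> b≰u

    u↗b : u ↗ b
    u↗b = ↗-intro b≤u u≤b

    v≤b : row v ≤ row b
    v≤b = ℤ.≤-trans (↗-row {a} a↗v) (↘-row {a} a↘b)

    b≤v : col b ≤ col v
    b≤v with col b ≤? col v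
    ... | yes b≤v = b≤v
    ... | no  b≰v = ⊥-elim (Ev∉τ (between sk τv τb (↘E v) (↘-E {v} (↘-intro v≤b (ℤ.<⇒≤ v<b)) v<b)))
      where v<b : col v < col b
            v<b = ℤ.≰⇒> b≰v

    b↗v : b ↗ v
    b↗v = ↗-intro v≤b b≤v

    SEb∉τ : ¬ ⟦ τ ⟧ (SE b)
    SEb∉τ τSEb = SEa∉τ (between sk τa τSEb (↘SE a) (↘-SE {a} a↘b))

  u∈ξ : ξ ⟦ τ ⟧ u v u
  u∈ξ = τu , ↗-refl , u↗v , λ τSEu → Su∉τ (between sk τu τSEu (↘S u) (↘E (S u)))

  -- If E w ∉ τ, then v lies strictly above w (else E w is squeezed between w and v), so
  -- north-or-east on the path from u to v gives N w ∈ τ; and SE (N w) = E w ∉ τ.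
  ξ-advance : ∀ {w} → ξ ⟦ τ ⟧ u v w → w ≢ v → ξ ⟦ τ ⟧ u v (N w) ⊎ ξ ⟦ τ ⟧ u v (E w)
  ξ-advance {w} ξw@(τw , u↗w , w↗v , _) w≢v with E w ∈? τ
  ... | yes τEw  = inj₂ (ξ-upClosed ξw τEw (↘E w))
  ... | no  Ew∉τ =
    inj₁ (τNw , ↗-intro Nw≤u (↗-col {u} u↗w) , ↗-intro (<⇒≤-1 v<w) (↗-col {w} w↗v) , SENw∉τ)
    where
    v<w : row v < row w
    v<w with row v <? row w
    ... | yes v<w = v<w
    ... | no  v≮w = ⊥-elim (Ew∉τ (between sk τw τv (↘E w) (↘-E {w} (↘-intro w≤v c≤) c<)))
      where
      w≤v : row w ≤ row v
      w≤v = ℤ.≮⇒≥ v≮w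
      c≤ : col w ≤ col v
      c≤ = ↗-col {w} w↗v
      c< : col w < col v
      c< = ℤ.≤∧≢⇒< c≤ λ c≡ → w≢v (cong₂ _,_ (ℤ.≤-antisym w≤v (↗-row {w} w↗v)) c≡)

    τNw : ⟦ τ ⟧ (N w)
    τNw with north-or-east sk τw path-u-v (↗-row {u} u↗w) v<w
    ... | inj₁ τNw = τNw
    ... | inj₂ τEw = ⊥-elim (Ew∉τ τEw)

    Nw≤u : row (N w) ≤ row u
    Nw≤u = ℤ.≤-trans (i-1≤i (row w)) (↗-row {u} u↗w)

    SENw∉τ : ¬ ⟦ τ ⟧ (SE (N w))
    SENw∉τ τSENw = Ew∉τ (subst ⟦ τ ⟧ (cong (_, col w + + 1) (i-1+1≡i (row w))) τSENw)

  ξ? : Decidable (ξ ⟦ τ ⟧ u v)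
  ξ? w = (w ∈? τ) ×-dec ↗? u w ×-dec ↗? w v ×-dec ¬? (SE w ∈? τ)

  ξ-ribbon : Ribbon (ξ ⟦ τ ⟧ u v)
  ξ-ribbon = (u , u∈ξ)
           , SE-free⇒thin sk (λ (τw , _ , _ , SEw∉τ) → τw , SEw∉τ)
           , connected-by-N/E-steps (λ (_ , _ , w↗v , _) → w↗v) ξ-advance
           , upClosed⇒skewShape sk (λ _ → proj₁) ξ-upClosed

  ξ-removable : SERemovable ⟦ τ ⟧ (ξ ⟦ τ ⟧ u v)
  ξ-removable = upClosed⇒removable τ sk ξ? (u , u∈ξ) (λ _ → proj₁) ξ-upClosed

module _ {τ : NodeSet} (sk : SkewShape τ) (ρ : List Node)
         (rib : Ribbon ⟦ ρ ⟧) (rem : SERemovable τ ⟦ ρ ⟧) where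

  private
    x₀ : Node
    x₀ = proj₁ (proj₁ rib)

    x₀∈ρ : x₀ ∈ ρ
    x₀∈ρ = proj₂ (proj₁ rib)

    ρ-thin : Thin ⟦ ρ ⟧
    ρ-thin = proj₁ (proj₂ rib)

    ρ-connected : Connected ⟦ ρ ⟧
    ρ-connected = proj₁ (proj₂ (proj₂ rib))

    ρ-skew : SkewShape ⟦ ρ ⟧
    ρ-skew = proj₂ (proj₂ (proj₂ rib))

    ρ⊆τ : ⟦ ρ ⟧ ⊆ τ
    ρ⊆τ = proj₁ (proj₂ rem)

    ρ-upClosed : UpClosed τ ⟦ ρ ⟧
    ρ-upClosed = removable⇒upClosed rem

    u₀ v₀ : Node
    u₀ = argmin diag x₀ ρ
    v₀ = argmax diag x₀ ρ

    u₀∈ρ : u₀ ∈ ρ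
    u₀∈ρ = argmin-all diag x₀∈ρ (tabulate λ w∈ρ → w∈ρ)

    v₀∈ρ : v₀ ∈ ρ
    v₀∈ρ = argmax-all diag x₀∈ρ (tabulate λ w∈ρ → w∈ρ)

    u₀-minimum : ∀ {w} → w ∈ ρ → diag u₀ ≤ diag w
    u₀-minimum = lookup (f[argmin]≤f[xs] {f = diag} x₀ ρ)

    v₀-maximum : ∀ {w} → w ∈ ρ → diag w ≤ diag v₀
    v₀-maximum = lookup (f[xs]≤f[argmax] {f = diag} x₀ ρ)

    path-u₀-v₀ : Path ⟦ ρ ⟧ u₀ v₀
    path-u₀-v₀ = ρ-connected u₀ v₀ u₀∈ρ v₀∈ρ

  removable-ribbon-rem : Rem τ u₀ v₀
  removable-ribbon-rem =
    (ρ⊆τ u₀ u₀∈ρ , ρ⊆τ v₀ v₀∈ρ , Path-map ρ⊆τ path-u₀-v₀) ,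
    diag-minimum⇒↗ ρ-skew u₀∈ρ u₀-minimum v₀∈ρ ,
    (λ τSu₀ → ℤ.<⇒≱ (diag-S< u₀) (u₀-minimum (ρ-upClosed u₀∈ρ τSu₀ (↘S u₀)))) ,
    (λ τEv₀ → ℤ.<⇒≱ (diag<diag-E v₀) (v₀-maximum (ρ-upClosed v₀∈ρ τEv₀ (↘E v₀))))

  removable-ribbon⊆ξ : ⟦ ρ ⟧ ⊆ ξ τ u₀ v₀
  removable-ribbon⊆ξ w w∈ρ =
    ρ⊆τ w w∈ρ ,
    diag-minimum⇒↗ ρ-skew u₀∈ρ u₀-minimum w∈ρ ,
    diag-maximum⇒↗ ρ-skew v₀∈ρ v₀-maximum w∈ρ ,
    λ τSEw → SE≢ w (ρ-thin (SE w) w (ρ-upClosed w∈ρ τSEw (↘SE w)) w∈ρ (diag-SE w))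

  ξ⊆removable-ribbon : ξ τ u₀ v₀ ⊆ ⟦ ρ ⟧
  ξ⊆removable-ribbon w (τw , u↗w , w↗v₀ , SEw∉τ)
    with Path-diag-ivt (diag w) path-u₀-v₀ (↗⇒diag≤ {u₀} u↗w) (↗⇒diag≤ {w} w↗v₀)
  ... | x , x∈ρ , x≡w with row x ≤? row w
  ...   | yes x≤w = ρ-upClosed x∈ρ τw (sameDiag⇒↘ {x} {w} x≡w x≤w)
  ...   | no  x≰w = ⊥-elim (SEw∉τ (SE-between sk τw (ρ⊆τ x x∈ρ) (sym x≡w) (ℤ.≰⇒> x≰w)))

  removable-ribbon≐ξ : ∃₂ λ u v → Rem τ u v × (⟦ ρ ⟧ ≐ ξ τ u v)
  removable-ribbon≐ξ = u₀ , v₀ , removable-ribbon-rem , removable-ribbon⊆ξ , ξ⊆removable-ribbon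

lemma2p16 : (τ : List Node) → SkewShape ⟦ τ ⟧ →
    (∀ u v → Rem ⟦ τ ⟧ u v →
      Ribbon (ξ ⟦ τ ⟧ u v) × SERemovable ⟦ τ ⟧ (ξ ⟦ τ ⟧ u v))
  × (∀ (ρ : List Node) → Ribbon ⟦ ρ ⟧ → SERemovable ⟦ τ ⟧ ⟦ ρ ⟧ →
      ∃₂ λ u v → Rem ⟦ τ ⟧ u v × (⟦ ρ ⟧ ≐ ξ ⟦ τ ⟧ u v))
lemma2p16 τ sk =
  (λ u v rem → ξ-ribbon sk rem , ξ-removable sk rem) ,
  (λ ρ rib rem → removable-ribbon≐ξ sk ρ rib rem)
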